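{- Let $G$ be a loopless graph and let $c$ and $d$ be two proper edge colorings of $G$ with colors from $\{1,\dots,n\}$ such that $c\sim d$. Suppose there is a vertex $v$ such that $c(e)=d(e)$ for every edge $e$ incident to $v$. Then there exists a sequence of edge-Kempe switches transforming $c$ into $d$ that never changes the color of any edge incident to $v$.
   Context: Graphs are finite and may have multiple edges. For a proper edge coloring of $G$ and two colors $a,b$, an edge-Kempe chain is a connected component of the subgraph formed by the edges colored $a$ or $b$; an edge-Kempe switch exchanges colors $a$ and $b$ on the edges of one such chain (producing another proper coloring). Two colorings $c,d$ satisfy $c\sim d$ (edge-Kempe equivalent) if one can be obtained from the other by a finite sequence of edge-Kempe switches. -}

module Defs where

open import Data.Nat using (ℕ)
open import Data.Fin using (Fin; _≟_)
open import Data.Product using (_×_; Σ; ∃; ∃-syntax; _,_; proj₁; proj₂)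
open import Data.Sum using (_⊎_)
open import Relation.Nullary using (¬_; yes; no)
open import Relation.Binary.PropositionalEquality using (_≡_)
open import Relation.Binary.Construct.Closure.ReflexiveTransitive using (Star)

-- A finite multigraph: vertices Fin V, edges Fin E, each edge has two endpoints.
-- Multiple edges are allowed (ends need not be injective).
record Multigraph : Set where
  field
    V    : ℕ
    E    : ℕ
    ends : Fin E → Fin V × Fin V

open Multigraph public

module _ (G : Multigraph) where

  Incident : Fin (E G) → Fin (V G) → Set
  Incident e v = proj₁ (ends G e) ≡ v ⊎ proj₂ (ends G e) ≡ v

  Loopless : Set
  Loopless = ∀ e → ¬ (proj₁ (ends G e) ≡ proj₂ (ends G e))

  ShareVertex : Fin (E G) → Fin (E G) → Set
  ShareVertex e f = ∃[ v ] (Incident e v × Incident f v)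

  -- edge colorings with colors {1..n} (represented as Fin n)
  Coloring : ℕ → Set
  Coloring n = Fin (E G) → Fin n

  Proper : ∀ {n} → Coloring n → Set
  Proper c = ∀ e f → ¬ (e ≡ f) → ShareVertex e f → ¬ (c e ≡ c f)

  InAB : ∀ {n} → Coloring n → Fin n → Fin n → Fin (E G) → Set
  InAB c a b e = c e ≡ a ⊎ c e ≡ b

  ABAdj : ∀ {n} → Coloring n → Fin n → Fin n → Fin (E G) → Fin (E G) → Set
  ABAdj c a b e f = InAB c a b e × InAB c a b f × ShareVertex e f

  InChain : ∀ {n} → Coloring n → Fin n → Fin n → Fin (E G) → Fin (E G) → Set
  InChain c a b e f = InAB c a b e × Star (ABAdj c a b) e f

swapCol : ∀ {n} → Fin n → Fin n → Fin n → Fin n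
swapCol a b x with x ≟ a
... | yes _ = b
... | no _ with x ≟ b
...   | yes _ = a
...   | no _ = x

module _ (G : Multigraph) where

  -- c' is obtained from c by an edge-Kempe switch: exchange colours a and b on
  -- the edge-Kempe chain containing edge e₀ (which has colour a or b).
  -- (Chains consisting of an isolated vertex give the identity switch,
  --  which is also Star-reflexivity, so they are omitted.)
  KempeSwitch : ∀ {n} → Coloring G n → Coloring G n → Set
  KempeSwitch {n} c c' =
    Σ (Fin n) λ a → Σ (Fin n) λ b → Σ (Fin (E G)) λ e₀ →
      InAB G c a b e₀ ×
      (∀ e → (InChain G c a b e₀ e → c' e ≡ swapCol a b (c e))
           × (¬ InChain G c a b e₀ e → c' e ≡ c e))

  KempeEquiv : ∀ {n} → Coloring G n → Coloring G n → Set
  KempeEquiv = Star KempeSwitch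

  KempeSwitchFixing : ∀ {n} → Fin (V G) → Coloring G n → Coloring G n → Set
  KempeSwitchFixing v c c' =
    KempeSwitch c c' × (∀ e → Incident G e v → c' e ≡ c e)

-- Follow the given Kempe sequence c = c₀, c₁, …, cₖ = d, maintaining a colour permutation σ such that
-- σ ∘ cᵢ agrees with d at v. A switch whose chain misses v is copied, relabelled by σ. If the chain K of a
-- switch on colours a, b meets v, then K contains every a/b-edge at v, so all other a/b-chains miss v;
-- switching those instead produces σ ∘ (a b) ∘ cᵢ₊₁, and the transposition (a b) is absorbed into σ.
-- At the end σ ∘ d agrees with d at v, so σ fixes every colour present at v; it is undone by
-- transpositions of colours absent at v, each realised by switching all chains of those two colours.

module Submission where

open import Defs
open import Data.Nat using (ℕ; zero; suc; _≤_; z≤n; s≤s)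
open import Data.Nat.Properties using (n<1+n)
open import Data.Fin using (Fin; toℕ; _≟_; _<_)
open import Data.Fin.Properties using (any?; all?; pigeonhole; toℕ≤pred[n])
open import Data.List using (List; []; _∷_; allFin)
open import Data.List.Relation.Unary.Any as Any using (Any; here; there)
open import Data.List.Membership.Propositional using (_∈_)
open import Data.List.Membership.Propositional.Properties using (∈-allFin)
open import Data.Product using (_×_; ∃-syntax; _,_; proj₁; proj₂)
open import Data.Sum using (_⊎_; inj₁; inj₂; [_,_])
open import Data.Empty using (⊥-elim)
open import Data.Unit using (⊤; tt)
open import Function using (_∘_)
open import Function.Definitions using (Injective)
open import Relation.Nullary using (¬_; Dec; yes; no)
open import Relation.Nullary.Decidable using (_×-dec_; _⊎-dec_; _→-dec_; ¬?; decidable-stable)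
open import Relation.Unary using (Decidable)
open import Relation.Binary.PropositionalEquality using (_≡_; _≗_; refl; sym; trans; cong; subst)
open import Relation.Binary.Construct.Closure.ReflexiveTransitive as Star using (Star; ε; _◅_; _◅◅_)

module _ {m : ℕ} {R : Fin m → Fin m → Set} (R? : ∀ x y → Dec (R x y)) (x : Fin m) where

  private
    ReachableIn : ℕ → Fin m → Set
    ReachableIn zero    y = x ≡ y
    ReachableIn (suc k) y = ReachableIn k y ⊎ ∃[ z ] (ReachableIn k z × R z y)

    reachableIn? : ∀ k → Decidable (ReachableIn k)
    reachableIn? zero    y = x ≟ y
    reachableIn? (suc k) y = reachableIn? k y ⊎-dec any? (λ z → reachableIn? k z ×-dec R? z y)

    reachableIn⇒star : ∀ k {y} → ReachableIn k y → Star R x y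
    reachableIn⇒star zero    refl               = ε
    reachableIn⇒star (suc k) (inj₁ r)           = reachableIn⇒star k r
    reachableIn⇒star (suc k) (inj₂ (z , r , s)) = reachableIn⇒star k r ◅◅ (s ◅ ε)

    reachableIn-mono : ∀ {k l y} → k ≤ l → ReachableIn k y → ReachableIn l y
    reachableIn-mono {zero}  {zero}  _       r                  = r
    reachableIn-mono {zero}  {suc l} _       r                  = inj₁ (reachableIn-mono {zero} {l} z≤n r)
    reachableIn-mono {suc k} {suc l} (s≤s p) (inj₁ r)           = inj₁ (reachableIn-mono p r)
    reachableIn-mono {suc k} {suc l} (s≤s p) (inj₂ (z , r , s)) = inj₂ (z , reachableIn-mono p r , s)

    Saturated : ℕ → Set
    Saturated k = ∀ y → ReachableIn (suc k) y → ReachableIn k y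

    saturated? : ∀ k → Dec (Saturated k)
    saturated? k = all? (λ y → reachableIn? (suc k) y →-dec reachableIn? k y)

    saturated-closed : ∀ {k z y} → Saturated k → ReachableIn k z → Star R z y → ReachableIn k y
    saturated-closed sat r ε       = r
    saturated-closed sat r (s ◅ p) = saturated-closed sat (sat _ (inj₂ (_ , r , s))) p

    grows : ∀ k → ¬ Saturated k → ∃[ y ] (ReachableIn (suc k) y × ¬ ReachableIn k y)
    grows k unsat with any? (λ y → reachableIn? (suc k) y ×-dec ¬? (reachableIn? k y))
    ... | yes new = new
    ... | no ¬new = ⊥-elim (unsat λ y r → decidable-stable (reachableIn? k y) (λ ¬r → ¬new (y , r , ¬r)))

    -- If none of the layers 0, …, m saturates, each contributes a vertex missing from the previous ones:
    -- m + 1 distinct vertices of Fin m.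
    saturates : ∃[ k ] (k ≤ m × Saturated k)
    saturates with any? (λ (i : Fin (suc m)) → saturated? (toℕ i))
    ... | yes (i , sat) = toℕ i , toℕ≤pred[n] i , sat
    ... | no unsat = ⊥-elim (newcomers-distinct (pigeonhole (n<1+n m) newcomer))
      where
      newcomer : Fin (suc m) → Fin m
      newcomer i = proj₁ (grows (toℕ i) (λ sat → unsat (i , sat)))
      newcomers-distinct : ¬ (∃[ i ] ∃[ j ] (i < j × newcomer i ≡ newcomer j))
      newcomers-distinct (i , j , i<j , same)
        with grows (toℕ i) (λ sat → unsat (i , sat)) | grows (toℕ j) (λ sat → unsat (j , sat))
      ... | _ , rᵢ , _ | _ , _ , ¬rⱼ = ¬rⱼ (subst (ReachableIn (toℕ j)) same (reachableIn-mono i<j rᵢ))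

  star? : Decidable (Star R x)
  star? y with reachableIn? m y
  ... | yes r = yes (reachableIn⇒star m r)
  ... | no ¬r = no λ p →
    let (k , k≤m , sat) = saturates
    in ¬r (reachableIn-mono k≤m (saturated-closed sat (reachableIn-mono z≤n refl) p))

module _ {n : ℕ} where

  data SwapView (a b x : Fin n) : Fin n → Set where
    swap-a     : x ≡ a → SwapView a b x b
    swap-b     : ¬ x ≡ a → x ≡ b → SwapView a b x a
    swap-other : ¬ x ≡ a → ¬ x ≡ b → SwapView a b x x

  swapView : ∀ a b x → SwapView a b x (swapCol a b x)
  swapView a b x with x ≟ a
  ... | yes x≡a = swap-a x≡a
  ... | no x≢a with x ≟ b
  ...   | yes x≡b = swap-b x≢a x≡b
  ...   | no x≢b  = swap-other x≢a x≢b

  swapCol-other : ∀ a b {x} → ¬ x ≡ a → ¬ x ≡ b → swapCol a b x ≡ x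
  swapCol-other a b {x} x≢a x≢b with swapCol a b x | swapView a b x
  ... | _ | swap-a x≡a     = ⊥-elim (x≢a x≡a)
  ... | _ | swap-b _ x≡b   = ⊥-elim (x≢b x≡b)
  ... | _ | swap-other _ _ = refl

  swapCol-diag : ∀ a x → swapCol a a x ≡ x
  swapCol-diag a x with swapCol a a x | swapView a a x
  ... | _ | swap-a x≡a     = sym x≡a
  ... | _ | swap-b x≢a x≡a = ⊥-elim (x≢a x≡a)
  ... | _ | swap-other _ _ = refl

  swapCol-left : ∀ a b → swapCol a b a ≡ b
  swapCol-left a b = swapCol-left′ (swapView a b a)
    where
    swapCol-left′ : ∀ {y} → SwapView a b a y → y ≡ b
    swapCol-left′ (swap-a _)         = refl
    swapCol-left′ (swap-b a≢a _)     = ⊥-elim (a≢a refl)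
    swapCol-left′ (swap-other a≢a _) = ⊥-elim (a≢a refl)

  swapCol-right : ∀ a b → swapCol a b b ≡ a
  swapCol-right a b = swapCol-right′ (swapView a b b)
    where
    swapCol-right′ : ∀ {y} → SwapView a b b y → y ≡ a
    swapCol-right′ (swap-a b≡a)       = b≡a
    swapCol-right′ (swap-b _ _)       = refl
    swapCol-right′ (swap-other _ b≢b) = ⊥-elim (b≢b refl)

  swapCol-involutive : ∀ a b x → swapCol a b (swapCol a b x) ≡ x
  swapCol-involutive a b x with swapCol a b x | swapView a b x
  ... | _ | swap-a x≡a         = trans (swapCol-right a b) (sym x≡a)
  ... | _ | swap-b _ x≡b       = trans (swapCol-left a b) (sym x≡b)
  ... | _ | swap-other x≢a x≢b = swapCol-other a b x≢a x≢b

  swapCol-injective : ∀ a b → Injective _≡_ _≡_ (swapCol a b)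
  swapCol-injective a b {x} {y} eq =
    trans (sym (swapCol-involutive a b x)) (trans (cong (swapCol a b) eq) (swapCol-involutive a b y))

  swapCol-natural : ∀ {σ : Fin n → Fin n} → Injective _≡_ _≡_ σ →
                    ∀ a b x → σ (swapCol a b x) ≡ swapCol (σ a) (σ b) (σ x)
  swapCol-natural {σ} σ-inj a b x with swapCol a b x | swapView a b x
  ... | _ | swap-a refl        = sym (swapCol-left (σ a) (σ b))
  ... | _ | swap-b _ refl      = sym (swapCol-right (σ a) (σ b))
  ... | _ | swap-other x≢a x≢b =
    sym (swapCol-other (σ a) (σ b) (x≢a ∘ σ-inj) (x≢b ∘ σ-inj))

  swapCol-pair : ∀ a b {x} → x ≡ a ⊎ x ≡ b → swapCol a b x ≡ a ⊎ swapCol a b x ≡ b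
  swapCol-pair a b {x} x∈ab with swapCol a b x | swapView a b x
  ... | _ | swap-a _       = inj₂ refl
  ... | _ | swap-b _ _     = inj₁ refl
  ... | _ | swap-other _ _ = x∈ab

  swapCol-pair⁻ : ∀ a b {x} → swapCol a b x ≡ a ⊎ swapCol a b x ≡ b → x ≡ a ⊎ x ≡ b
  swapCol-pair⁻ a b {x} sx∈ab =
    subst (λ y → y ≡ a ⊎ y ≡ b) (swapCol-involutive a b x) (swapCol-pair a b sx∈ab)

  module _ {τ : Fin n → Fin n} (τ-inj : Injective _≡_ _≡_ τ) {k : Fin n} (τk≢k : ¬ τ k ≡ k) {x : Fin n}
           (τx≡x : τ x ≡ x) where

    fixed≢moved : ¬ x ≡ k
    fixed≢moved refl = τk≢k τx≡x

    fixed≢image : ¬ x ≡ τ k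
    fixed≢image x≡τk = fixed≢moved (τ-inj (trans τx≡x x≡τk))

    swapCol-moved-fixed : swapCol k (τ k) (τ x) ≡ x
    swapCol-moved-fixed =
      trans (cong (swapCol k (τ k)) τx≡x) (swapCol-other k (τ k) fixed≢moved fixed≢image)

module _ (G : Multigraph) where

  incident? : ∀ e u → Dec (Incident G e u)
  incident? e u = (proj₁ (ends G e) ≟ u) ⊎-dec (proj₂ (ends G e) ≟ u)

  shareVertex? : ∀ e f → Dec (ShareVertex G e f)
  shareVertex? e f = any? (λ u → incident? e u ×-dec incident? f u)

  module _ {n : ℕ} where

    inAB? : ∀ (c : Coloring G n) a b → Decidable (InAB G c a b)
    inAB? c a b e = (c e ≟ a) ⊎-dec (c e ≟ b)

    abAdj? : ∀ (c : Coloring G n) a b e f → Dec (ABAdj G c a b e f)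
    abAdj? c a b e f = inAB? c a b e ×-dec inAB? c a b f ×-dec shareVertex? e f

    inChain? : ∀ (c : Coloring G n) a b e₀ → Decidable (InChain G c a b e₀)
    inChain? c a b e₀ e = inAB? c a b e₀ ×-dec star? (abAdj? c a b) e₀ e

    abAdj-sym : ∀ {c : Coloring G n} {a b e f} → ABAdj G c a b e f → ABAdj G c a b f e
    abAdj-sym (i₁ , i₂ , u , inc-e , inc-f) = i₂ , i₁ , u , inc-f , inc-e

    inChain-InAB : ∀ {c : Coloring G n} {a b e₀ e} → InChain G c a b e₀ e → InAB G c a b e
    inChain-InAB (i₀ , path) = along i₀ path
      where
      along : ∀ {c : Coloring G n} {a b e f} → InAB G c a b e → Star (ABAdj G c a b) e f → InAB G c a b f
      along i ε                    = i
      along _ ((_ , i , _) ◅ path) = along i path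

    inChain-sym : ∀ {c : Coloring G n} {a b e f} → InChain G c a b e f → InChain G c a b f e
    inChain-sym ch@(_ , path) = inChain-InAB ch , Star.reverse abAdj-sym path

    inChain-trans : ∀ {c : Coloring G n} {a b e f g} →
                    InChain G c a b e f → InChain G c a b f g → InChain G c a b e g
    inChain-trans (i , p) (_ , q) = i , p ◅◅ q

    inChain-extend : ∀ {c : Coloring G n} {a b e f g} →
                     InChain G c a b e f → ABAdj G c a b f g → InChain G c a b e g
    inChain-extend (i , p) adj = i , p ◅◅ (adj ◅ ε)

    inChain-transfer : ∀ {c c' : Coloring G n} {a b a' b'} →
                       (∀ {e} → InAB G c a b e → InAB G c' a' b' e) →
                       ∀ {e₀ e} → InChain G c a b e₀ e → InChain G c' a' b' e₀ e
    inChain-transfer h (i , p) = h i , Star.map (λ (i₁ , i₂ , sh) → h i₁ , h i₂ , sh) p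

    SwappedOn : (Fin (E G) → Set) → Fin n → Fin n → Coloring G n → Coloring G n → Set
    SwappedOn P a b φ ψ = ∀ e → (P e → ψ e ≡ swapCol a b (φ e)) × (¬ P e → ψ e ≡ φ e)

    swapOn : {P : Fin (E G) → Set} → Decidable P → Fin n → Fin n → Coloring G n → Coloring G n
    swapOn P? a b φ e with P? e
    ... | yes _ = swapCol a b (φ e)
    ... | no _  = φ e

    swapOn-swapped : ∀ {P} (P? : Decidable P) a b φ → SwappedOn P a b φ (swapOn P? a b φ)
    swapOn-swapped P? a b φ e with P? e
    ... | yes p = (λ _ → refl) , (λ ¬p → ⊥-elim (¬p p))
    ... | no ¬p = (λ p → ⊥-elim (¬p p)) , (λ _ → refl)

    swapCol-outside : ∀ {φ : Coloring G n} {a b e} → ¬ InAB G φ a b e → swapCol a b (φ e) ≡ φ e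
    swapCol-outside {a = a} {b} ¬i = swapCol-other a b (¬i ∘ inj₁) (¬i ∘ inj₂)

    module _ {P : Fin (E G) → Set} {a b : Fin n} {φ ψ : Coloring G n} (swapped : SwappedOn P a b φ ψ) where

      swappedOn-InAB : ∀ {e} → Dec (P e) → InAB G φ a b e → InAB G ψ a b e
      swappedOn-InAB {e} (yes p) i rewrite proj₁ (swapped e) p = swapCol-pair a b i
      swappedOn-InAB {e} (no ¬p) i rewrite proj₂ (swapped e) ¬p = i

      swappedOn-InAB⁻ : ∀ {e} → Dec (P e) → InAB G ψ a b e → InAB G φ a b e
      swappedOn-InAB⁻ {e} (yes p) i rewrite proj₁ (swapped e) p = swapCol-pair⁻ a b i
      swappedOn-InAB⁻ {e} (no ¬p) i rewrite proj₂ (swapped e) ¬p = i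

      swappedOn-complement : Decidable P → SwappedOn (¬_ ∘ P) a b φ (swapCol a b ∘ ψ)
      swappedOn-complement P? e with P? e
      ... | yes p  = (λ ¬p → ⊥-elim (¬p p))
                   , (λ _ → trans (cong (swapCol a b) (proj₁ (swapped e) p)) (swapCol-involutive a b (φ e)))
      ... | no ¬p  = (λ _ → cong (swapCol a b) (proj₂ (swapped e) ¬p))
                   , (λ ¬¬p → ⊥-elim (¬¬p ¬p))

      swappedOn-resp : ∀ {Q : Fin (E G) → Set} → (∀ {e} → P e → Q e) → (∀ {e} → Q e → P e) →
                       SwappedOn Q a b φ ψ
      swappedOn-resp P⇒Q Q⇒P e = proj₁ (swapped e) ∘ Q⇒P , λ ¬q → proj₂ (swapped e) (¬q ∘ P⇒Q)

      swappedOn-agree : ∀ {Q ψ' e} → Dec (P e) → Dec (Q e) →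
                        (InAB G φ a b e → (P e → Q e) × (Q e → P e)) →
                        SwappedOn Q a b φ ψ' → ψ e ≡ ψ' e
      swappedOn-agree {e = e} (yes p) (yes q) _ swapped' =
        trans (proj₁ (swapped e) p) (sym (proj₁ (swapped' e) q))
      swappedOn-agree {e = e} (no ¬p) (no ¬q) _ swapped' =
        trans (proj₂ (swapped e) ¬p) (sym (proj₂ (swapped' e) ¬q))
      swappedOn-agree {e = e} (yes p) (no ¬q) agree swapped' =
        trans (proj₁ (swapped e) p)
              (trans (swapCol-outside {φ = φ} (λ i → ¬q (proj₁ (agree i) p)))
                     (sym (proj₂ (swapped' e) ¬q)))
      swappedOn-agree {e = e} (no ¬p) (yes q) agree swapped' =
        trans (proj₂ (swapped e) ¬p)
              (trans (sym (swapCol-outside {φ = φ} (λ i → ¬p (proj₂ (agree i) q))))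
                     (sym (proj₁ (swapped' e) q)))

    module _ {σ : Fin n → Fin n} (σ-inj : Injective _≡_ _≡_ σ) {c : Coloring G n} {a b : Fin n} where

      relabel-InAB : ∀ {e} → InAB G c a b e → InAB G (σ ∘ c) (σ a) (σ b) e
      relabel-InAB (inj₁ eq) = inj₁ (cong σ eq)
      relabel-InAB (inj₂ eq) = inj₂ (cong σ eq)

      relabel-InAB⁻ : ∀ {e} → InAB G (σ ∘ c) (σ a) (σ b) e → InAB G c a b e
      relabel-InAB⁻ (inj₁ eq) = inj₁ (σ-inj eq)
      relabel-InAB⁻ (inj₂ eq) = inj₂ (σ-inj eq)

      relabel-ABAdj⁻ : ∀ {e f} → ABAdj G (σ ∘ c) (σ a) (σ b) e f → ABAdj G c a b e f
      relabel-ABAdj⁻ (i₁ , i₂ , sh) = relabel-InAB⁻ i₁ , relabel-InAB⁻ i₂ , sh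

      relabel-swappedOn : ∀ {P c'} → SwappedOn P a b c c' → SwappedOn P (σ a) (σ b) (σ ∘ c) (σ ∘ c')
      relabel-swappedOn swapped e =
          (λ p → trans (cong σ (proj₁ (swapped e) p)) (swapCol-natural σ-inj a b (c e)))
        , (λ ¬p → cong σ (proj₂ (swapped e) ¬p))

    relabel-switch : ∀ {σ : Fin n → Fin n} → Injective _≡_ _≡_ σ → ∀ {c c'} →
                     KempeSwitch G c c' → KempeSwitch G (σ ∘ c) (σ ∘ c')
    relabel-switch σ-inj {c} (a , b , e₀ , i₀ , swapped) =
      _ , _ , e₀ , relabel-InAB σ-inj {c} i₀ ,
      swappedOn-resp (relabel-swappedOn σ-inj swapped)
        (inChain-transfer (relabel-InAB σ-inj {c})) (inChain-transfer (relabel-InAB⁻ σ-inj {c}))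

module Fixing (G : Multigraph) {n : ℕ} (v : Fin (V G)) (e* : Fin (E G)) where

  _⇝_ : Coloring G n → Coloring G n → Set
  _⇝_ = Star (KempeSwitchFixing G v)

  -- Without function extensionality, pointwise equal colourings must be joined by a switch; swapping a
  -- colour with itself (on the chain of an arbitrary edge e*) is one.
  ≗⇒switch : ∀ {φ ψ : Coloring G n} → ψ ≗ φ → KempeSwitchFixing G v φ ψ
  ≗⇒switch {φ} ψ≗φ =
    ( φ e* , φ e* , e* , inj₁ refl
    , λ e → (λ _ → trans (ψ≗φ e) (sym (swapCol-diag (φ e*) (φ e)))) , (λ _ → ψ≗φ e))
    , λ e _ → ψ≗φ e

  ⇝-respʳ-≗ : ∀ {φ ψ χ : Coloring G n} → φ ⇝ ψ → χ ≗ ψ → φ ⇝ χ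
  ⇝-respʳ-≗ path χ≗ψ = path ◅◅ (≗⇒switch χ≗ψ ◅ ε)

  module _ (φ : Coloring G n) (α β : Fin n) {S : Fin (E G) → Set} (S? : Decidable S)
           (S-closed : ∀ {e f} → S e → ABAdj G φ α β e f → S f)
           (S-avoids-v : ∀ {e} → S e → InAB G φ α β e → ¬ Incident G e v) where

    private
      SweptBy : List (Fin (E G)) → Fin (E G) → Set
      SweptBy js e = Any (λ j → S j × InChain G φ α β j e) js

      sweptBy? : ∀ js → Decidable (SweptBy js)
      sweptBy? js e = Any.any? (λ j → S? j ×-dec inChain? G φ α β j e) js

      sweep : List (Fin (E G)) → Coloring G n
      sweep js = swapOn G (sweptBy? js) α β φ

      sweep-swapped : ∀ js → SwappedOn G (SweptBy js) α β φ (sweep js)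
      sweep-swapped js = swapOn-swapped G (sweptBy? js) α β φ

      S-closed-star : ∀ {j e} → S j → Star (ABAdj G φ α β) j e → S e
      S-closed-star s ε            = s
      S-closed-star s (adj ◅ path) = S-closed-star (S-closed s adj) path

      sweep-InChain : ∀ js {j e} → InChain G φ α β j e → InChain G (sweep js) α β j e
      sweep-InChain js = inChain-transfer G (swappedOn-InAB G (sweep-swapped js) (sweptBy? js _))

      sweep-InChain⁻ : ∀ js {j e} → InChain G (sweep js) α β j e → InChain G φ α β j e
      sweep-InChain⁻ js = inChain-transfer G (swappedOn-InAB⁻ G (sweep-swapped js) (sweptBy? js _))

      sweptBy-absorbs : ∀ {j js e} → (S j → InAB G φ α β j → SweptBy js j) →
                        SweptBy (j ∷ js) e → SweptBy js e
      sweptBy-absorbs j-swept (here (s , ch)) =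
        Any.map (λ (s' , ch') → s' , inChain-trans G ch' ch) (j-swept s (proj₁ ch))
      sweptBy-absorbs _ (there swept) = swept

      sweptBy-fresh : ∀ {j js e} → ¬ SweptBy js j → InChain G φ α β j e → ¬ SweptBy js e
      sweptBy-fresh ¬j-swept ch swept =
        ¬j-swept (Any.map (λ (s , ch') → s , inChain-trans G ch' (inChain-sym G ch)) swept)

      sweep-absorbs : ∀ {j js} → (S j → InAB G φ α β j → SweptBy js j) → sweep (j ∷ js) ≗ sweep js
      sweep-absorbs {j} {js} j-swept e =
        swappedOn-agree G (sweep-swapped (j ∷ js)) (sweptBy? (j ∷ js) e) (sweptBy? js e)
          (λ _ → sweptBy-absorbs j-swept , there) (sweep-swapped js)

      -- The chain of j lies in S, hence misses v.
      sweep-fresh-chain : ∀ {j js} → S j → InAB G φ α β j → ¬ SweptBy js j →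
                          KempeSwitchFixing G v (sweep js) (sweep (j ∷ js))
      sweep-fresh-chain {j} {js} s i ¬j-swept =
        ( α , β , j , swappedOn-InAB G (sweep-swapped js) (sweptBy? js j) i
        , λ e → on-chain e ∘ sweep-InChain⁻ js , λ ¬ch → off-chain e (¬ch ∘ sweep-InChain js))
        , λ e inc → off-chain e λ ch → S-avoids-v (S-closed-star s (proj₂ ch)) (inChain-InAB G ch) inc
        where
        on-chain : ∀ e → InChain G φ α β j e → sweep (j ∷ js) e ≡ swapCol α β (sweep js e)
        on-chain e ch =
          trans (proj₁ (sweep-swapped (j ∷ js) e) (here (s , ch)))
                (cong (swapCol α β) (sym (proj₂ (sweep-swapped js e) (sweptBy-fresh ¬j-swept ch))))
        off-chain : ∀ e → ¬ InChain G φ α β j e → sweep (j ∷ js) e ≡ sweep js e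
        off-chain e ¬ch =
          swappedOn-agree G (sweep-swapped (j ∷ js)) (sweptBy? (j ∷ js) e) (sweptBy? js e)
            (λ _ → (λ { (here (_ , ch)) → ⊥-elim (¬ch ch) ; (there swept) → swept }) , there)
            (sweep-swapped js)

      sweep-step : ∀ j js → KempeSwitchFixing G v (sweep js) (sweep (j ∷ js))
      sweep-step j js with sweptBy? js j | S? j ×-dec inAB? G φ α β j
      ... | yes j-swept | _           = ≗⇒switch (sweep-absorbs (λ _ _ → j-swept))
      ... | no _        | no ¬s×i     = ≗⇒switch (sweep-absorbs (λ s i → ⊥-elim (¬s×i (s , i))))
      ... | no ¬j-swept | yes (s , i) = sweep-fresh-chain s i ¬j-swept

      sweep-path : ∀ js → φ ⇝ sweep js
      sweep-path []       = ≗⇒switch (λ e → proj₂ (sweep-swapped [] e) λ ()) ◅ ε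
      sweep-path (j ∷ js) = sweep-path js ◅◅ (sweep-step j js ◅ ε)

    swap-chains : ∀ {ψ} → SwappedOn G S α β φ ψ → φ ⇝ ψ
    swap-chains swapped = ⇝-respʳ-≗ (sweep-path (allFin (E G))) λ e →
      swappedOn-agree G swapped (S? e) (sweptBy? (allFin (E G)) e)
        (λ i → (λ s → Any.map (λ { refl → s , i , ε }) (∈-allFin e)) , swept-in-S)
        (sweep-swapped (allFin (E G)))
      where
      swept-in-S : ∀ {js e} → SweptBy js e → S e
      swept-in-S swept with _ , s , _ , path ← Any.satisfied swept = S-closed-star s path

  swap-colours : ∀ φ a b → (∀ {e} → InAB G φ a b e → ¬ Incident G e v) → φ ⇝ (swapCol a b ∘ φ)
  swap-colours φ a b avoids-v =
    swap-chains φ a b (λ _ → yes tt) (λ _ _ → tt) (λ _ → avoids-v)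
      (λ e → (λ _ → refl) , (λ ¬⊤ → ⊥-elim (¬⊤ tt)))

  permute-colours : ∀ {τ φ} → Injective _≡_ _≡_ τ → (∀ e → Incident G e v → τ (φ e) ≡ φ e) →
                    (τ ∘ φ) ⇝ φ
  permute-colours {φ = φ} τ-inj fixes-v = untangle (allFin n) τ-inj fixes-v (λ j → inj₁ (∈-allFin j))
    where
    shrink : ∀ {k ks} {τ τ' : Fin n → Fin n} → τ' k ≡ k → (∀ {j} → τ j ≡ j → τ' j ≡ j) →
             (∀ j → j ∈ k ∷ ks ⊎ τ j ≡ j) → ∀ j → j ∈ ks ⊎ τ' j ≡ j
    shrink τ'k≡k keeps fixed j with fixed j
    ... | inj₁ (here refl)  = inj₂ τ'k≡k
    ... | inj₁ (there j∈ks) = inj₁ j∈ks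
    ... | inj₂ τj≡j         = inj₂ (keeps τj≡j)

    -- A moved colour k and its image τ k are both absent at v, so they can be exchanged.
    untangle : ∀ ks {τ} → Injective _≡_ _≡_ τ → (∀ e → Incident G e v → τ (φ e) ≡ φ e) →
               (∀ j → j ∈ ks ⊎ τ j ≡ j) → (τ ∘ φ) ⇝ φ
    untangle [] _ _ fixed = ≗⇒switch (λ e → [ (λ ()) , sym ] (fixed (φ e))) ◅ ε
    untangle (k ∷ ks) {τ} τ-inj fixes-v fixed with τ k ≟ k
    ... | yes τk≡k = untangle ks τ-inj fixes-v (shrink τk≡k (λ τj≡j → τj≡j) fixed)
    ... | no τk≢k  =
      swap-colours (τ ∘ φ) k (τ k) avoids-v ◅◅
      untangle ks (λ eq → τ-inj (swapCol-injective k (τ k) eq))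
        (λ e inc → swapCol-moved-fixed τ-inj τk≢k (fixes-v e inc))
        (shrink (swapCol-right k (τ k)) (swapCol-moved-fixed τ-inj τk≢k) fixed)
      where
      avoids-v : ∀ {e} → InAB G (τ ∘ φ) k (τ k) e → ¬ Incident G e v
      avoids-v (inj₁ eq) inc = fixed≢moved τ-inj τk≢k (fixes-v _ inc) (trans (sym (fixes-v _ inc)) eq)
      avoids-v (inj₂ eq) inc = fixed≢image τ-inj τk≢k (fixes-v _ inc) (trans (sym (fixes-v _ inc)) eq)

  module _ {c c' : Coloring G n} {a b e₀} (swapped : SwappedOn G (InChain G c a b e₀) a b c c')
           {ev} (ev-at-v : Incident G ev v) (ev-on-chain : InChain G c a b e₀ ev) where

    chain-covers-v : ∀ {e} → Incident G e v → InAB G c a b e → InChain G c a b e₀ e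
    chain-covers-v inc i =
      inChain-extend G {c = c} ev-on-chain (inChain-InAB G ev-on-chain , i , v , ev-at-v , inc)

    -- Swapping every other a/b-chain instead yields c' with the names a and b exchanged.
    swap-other-chains : ∀ {σ} → Injective _≡_ _≡_ σ → (σ ∘ c) ⇝ (σ ∘ swapCol a b ∘ c')
    swap-other-chains {σ} σ-inj =
      swap-chains (σ ∘ c) (σ a) (σ b) (¬? ∘ inChain? G c a b e₀) closed avoids-v
        (relabel-swappedOn G σ-inj (swappedOn-complement G swapped (inChain? G c a b e₀)))
      where
      closed : ∀ {e f} → ¬ InChain G c a b e₀ e → ABAdj G (σ ∘ c) (σ a) (σ b) e f →
               ¬ InChain G c a b e₀ f
      closed ¬ch adj ch = ¬ch (inChain-extend G ch (abAdj-sym G (relabel-ABAdj⁻ G σ-inj {c} adj)))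
      avoids-v : ∀ {e} → ¬ InChain G c a b e₀ e → InAB G (σ ∘ c) (σ a) (σ b) e → ¬ Incident G e v
      avoids-v ¬ch i inc = ¬ch (chain-covers-v inc (relabel-InAB⁻ G σ-inj {c} i))

    unswapped-at-v : ∀ {e} → Incident G e v → swapCol a b (c' e) ≡ c e
    unswapped-at-v {e} inc with inChain? G c a b e₀ e
    ... | yes ch = trans (cong (swapCol a b) (proj₁ (swapped e) ch)) (swapCol-involutive a b (c e))
    ... | no ¬ch = trans (cong (swapCol a b) (proj₂ (swapped e) ¬ch))
                         (swapCol-outside G {φ = c} (¬ch ∘ chain-covers-v inc))

  kempe⇒fixing : ∀ {σ c d} → Injective _≡_ _≡_ σ → KempeEquiv G c d →
                 (∀ e → Incident G e v → σ (c e) ≡ d e) → (σ ∘ c) ⇝ d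
  kempe⇒fixing σ-inj ε agree = permute-colours σ-inj agree
  kempe⇒fixing {σ} {c} σ-inj (_◅_ {j = c'} s@(a , b , e₀ , _ , swapped) rest) agree
    with any? (λ e → incident? G e v ×-dec inChain? G c a b e₀ e)
  ... | no ¬meets =
    (relabel-switch G σ-inj s , λ e inc → cong σ (unchanged e inc)) ◅
    kempe⇒fixing σ-inj rest (λ e inc → trans (cong σ (unchanged e inc)) (agree e inc))
    where
    unchanged : ∀ e → Incident G e v → c' e ≡ c e
    unchanged e inc = proj₂ (swapped e) (λ ch → ¬meets (e , inc , ch))
  ... | yes (ev , ev-at-v , ev-on-chain) =
    swap-other-chains swapped ev-at-v ev-on-chain σ-inj ◅◅
    kempe⇒fixing (λ eq → swapCol-injective a b (σ-inj eq)) rest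
      (λ e inc → trans (cong σ (unswapped-at-v swapped ev-at-v ev-on-chain inc)) (agree e inc))

theorem3p1 : (G : Multigraph) → Loopless G → (n : ℕ) →
    (c d : Coloring G n) → Proper G c → Proper G d →
    KempeEquiv G c d →
    (v : Fin (V G)) → (∀ e → Incident G e v → c e ≡ d e) →
    Star (KempeSwitchFixing G v) c d
theorem3p1 G _ n c d _ _ ε                               v _     = ε
theorem3p1 G _ n c d _ _ kempe@((_ , _ , e₀ , _) ◅ _) v agree =
  Fixing.kempe⇒fixing G v e₀ {σ = λ x → x} (λ eq → eq) kempe agree
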